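{- Let $H$ be any outcome of the construction below. Let $0\le i<k$, fix $x,y\in V$, and let $m=\max\{d_G(x,p_i(x)),d_G(y,p_i(y)),d_G(x,y)\}$. Then at least one of the following holds: (1) $d_H(x,y)\le 5m$; (2) $d_H(x,p_{i+1}(x))\le 4m$.
   Context: Let $G=(V,E,w)$ be an undirected graph on $n$ vertices with non-negative edge weights, $d_G$ its shortest-path distance, and $k\ge1$ an integer; $\nu=1/(2^k-1)$. Let $A_0=V$, $A_k=\emptyset$, and for $0\le i\le k-2$ let $A_{i+1}$ be obtained by including each element of $A_i$ independently with probability $q_i=n^{ -2^i\nu}\cdot 2^{ -2^i-1}$. For $0\le i\le k-1$ and $v\in V$, the pivot $p_i(v)$ is the vertex of $A_i$ closest to $v$ in $d_G$ (ties broken lexicographically), so $p_0(v)=v$; $p_k(v)$ does not exist, and a condition bounding the distance from $x$ to $p_k(x)$ is regarded as false. Let $d_G(u,A_{i+1})=\min_{a\in A_{i+1}}d_G(u,a)$ ($=\infty$ if $A_{i+1}=\emptyset$). For $u\in A_i\setminus A_{i+1}$, the bunch is $B(u)=\{v\in A_i: d_G(u,v)<d_G(u,A_{i+1})\}\cup\{p_j(u): i<j<k\}$. $H$ is the graph on $V$ with edges $\{u,v\}$ for all $u\in V$, $v\in B(u)$, of weight $d_G(u,v)$; $d_H$ is its shortest-path distance.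
   Formalization: The edge weights of $G$ are non-negative rational numbers. -}

module Defs where

open import Data.Nat using (ℕ; suc) renaming (_<_ to _<ℕ_)
open import Data.Fin using (Fin) renaming (_≤_ to _≤ᶠ_)
open import Data.Fin.Subset using (Subset; _∈_; _∉_; _⊆_; ⊤; ⊥)
open import Data.Maybe using (Maybe; just)
open import Data.Rational using (ℚ; 0ℚ; _+_; _≤_; _<_)
open import Data.Product using (Σ; _×_; ∃)
open import Data.Sum using (_⊎_)
open import Relation.Binary.PropositionalEquality using (_≡_)

-- A finite undirected weighted graph on vertex set Fin n.
-- edge u v ≡ just c : there is an edge {u,v} of (non-negative) weight c
-- (parallel edges are irrelevant for distances; nothing = no edge).
record Graph (n : ℕ) : Set where
  field
    edge    : Fin n → Fin n → Maybe ℚ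
    sym     : ∀ u v → edge u v ≡ edge v u
    nonneg  : ∀ u v c → edge u v ≡ just c → 0ℚ ≤ c
open Graph public

EdgeRel : ℕ → Set₁
EdgeRel n = Fin n → Fin n → ℚ → Set

GEdge : ∀ {n} → Graph n → EdgeRel n
GEdge G u v c = edge G u v ≡ just c

data Walk {n : ℕ} (E : EdgeRel n) : Fin n → Fin n → ℚ → Set where
  here : ∀ {u} → Walk E u u 0ℚ
  step : ∀ {u v z c d} → E u v c → Walk E v z d → Walk E u z (c + d)

-- d_E(u,v) ≤ D   (distance is a minimum over walks, ∞ if no walk)
DistLeq : ∀ {n} → EdgeRel n → Fin n → Fin n → ℚ → Set
DistLeq E u v D = Σ ℚ λ c → Walk E u v c × c ≤ D

IsDist : ∀ {n} → EdgeRel n → Fin n → Fin n → ℚ → Set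
IsDist E u v c = Walk E u v c × (∀ c' → Walk E u v c' → c ≤ c')

-- d_E(u,v) ≤ d_E(w,z)   (in [0,∞], min over walks)
DistLeDist : ∀ {n} → EdgeRel n → Fin n → Fin n → Fin n → Fin n → Set
DistLeDist E u v w z = ∀ c' → Walk E w z c' → DistLeq E u v c'

-- d_E(u,v) < d_E(u,A) = min_{a ∈ A} d_E(u,a)   (= ∞ if A = ∅)
DistLtSet : ∀ {n} → EdgeRel n → Fin n → Fin n → Subset n → Set
DistLtSet {n} E u v A =
  Σ ℚ λ c → Walk E u v c × (∀ (a : Fin n) → a ∈ A → ∀ c' → Walk E u a c' → c < c')

-- p is the pivot of v in A: the vertex of A closest to v in d_G,
-- ties broken towards the smaller vertex index. No pivot exists if A = ∅.
IsPivot : ∀ {n} → Graph n → Subset n → Fin n → Fin n → Set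
IsPivot {n} G A v p =
  p ∈ A × (∀ (a : Fin n) → a ∈ A →
             DistLeDist (GEdge G) v p v a × (DistLeDist (GEdge G) v a v p → p ≤ᶠ a))

-- p_i(v) = p, following the convention p_0(v) = v stated in the paper
-- (for i ≥ 1, the closest vertex of A_i with lexicographic tie-breaking).
IsPivotAt : ∀ {n} → Graph n → (ℕ → Subset n) → ℕ → Fin n → Fin n → Set
IsPivotAt G A 0 v p = p ≡ v
IsPivotAt G A (suc i) v p = IsPivot G (A (suc i)) v p

-- A valid outcome of the sampling: A₀ = V, A_k = ∅, A_{i+1} ⊆ A_i.
-- (Each such nested family has positive probability since 0 < q_i < 1.)
record Hierarchy {n : ℕ} (k : ℕ) (A : ℕ → Subset n) : Set where
  field
    A0    : A 0 ≡ ⊤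
    Ak    : A k ≡ ⊥
    nest  : ∀ i → i <ℕ k → A (suc i) ⊆ A i
open Hierarchy public

InBunch : ∀ {n} → Graph n → ℕ → (ℕ → Subset n) → Fin n → Fin n → Set
InBunch G k A u v =
  Σ ℕ λ i → i <ℕ k × u ∈ A i × u ∉ A (suc i) ×
    ( (v ∈ A i × DistLtSet (GEdge G) u v (A (suc i)))
    ⊎ (Σ ℕ λ j → i <ℕ j × j <ℕ k × IsPivotAt G A j u v) )

-- Edges of H: {u,v} with v ∈ B(u) (or u ∈ B(v)), weight d_G(u,v)
-- (an edge whose d_G-weight is ∞ contributes nothing).
HEdge : ∀ {n} → Graph n → ℕ → (ℕ → Subset n) → EdgeRel n
HEdge G k A u v c = (InBunch G k A u v ⊎ InBunch G k A v u) × IsDist (GEdge G) u v c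

-- Let a and b be the vertices of A_i nearest to x and y (x itself if x ∈ A_i, otherwise its pivot,
-- which lies in the bunch of x); both are reached in H at cost at most m, and d_G(a,b) ≤ 3m.
-- Either d_G(a,b) < d_G(a,A_{i+1}), so that b ∈ B(a) and H has the path x–a–b–y of weight at
-- most 5m, or some vertex of A_{i+1} lies within 3m of a and hence within 4m of x, and then so
-- does p_{i+1}(x). The pivot p_{i+1}(x) is reached in H at cost d_G(x,p_{i+1}(x)): it is in the
-- bunch of x unless x ∈ A_{i+1}; in that case the two are at distance 0, and vertices of A_j at
-- distance 0 are joined in H at cost 0, by downward induction on j (climb both to A_{j+1} through
-- their pivots, unless A_{j+1} is at positive distance, when they are in each other's bunch).
-- Distances are not given as functions, so shortest walks (sought among walks without repeated
-- vertices, weights being non-negative) and pivots must first be shown to exist.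
module Submission where

open import Defs
open import Data.Empty using (⊥-elim)
open import Data.Fin using (Fin; zero; suc) renaming (_≤_ to _≤ᶠ_; _<_ to _<ᶠ_)
import Data.Fin.Properties as Fin
open import Data.Fin.Subset using (Subset; _∈_; _∉_)
open import Data.Fin.Subset.Properties using (_∈?_; ∈⊤; ∉⊥)
open import Data.Integer using (+_)
open import Data.List using (List; []; _∷_; length; lookup)
open import Data.List.Membership.Propositional using () renaming (_∈_ to _∈ₗ_)
open import Data.List.Membership.Propositional.Properties using (∈-lookup)
import Data.List.Relation.Unary.All as All
open import Data.List.Relation.Unary.All.Properties using (¬Any⇒All¬)
open import Data.List.Relation.Unary.AllPairs using ([]; _∷_)
open import Data.List.Relation.Unary.Any using (here; there)
open import Data.List.Relation.Unary.Unique.Propositional using (Unique)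
open import Data.Maybe using (just; nothing)
open import Data.Maybe.Properties using (just-injective)
open import Data.Nat using (ℕ; zero; suc; z≤n; s≤s; _∸_) renaming (_+_ to _+ℕ_; _<_ to _<ℕ_; _≤_ to _≤ℕ_)
import Data.Nat.Properties as ℕ
open import Data.Product using (Σ; ∃; _×_; _,_; proj₁; proj₂)
open import Data.Rational using (ℚ; 0ℚ; _/_; _+_; _*_; _⊔_; _≤_; _<_)
open import Data.Rational.Properties
  using (≤-refl; ≤-trans; ≤-total; ≤-reflexive; _≤?_; _<?_; <-≤-trans; ≤-<-trans; ≮⇒≥; <-irrefl;
         +-identityˡ; +-identityʳ; +-assoc; +-comm; +-mono-≤; +-monoʳ-≤;
         p≤p⊔q; p≤q⊔p; p≤q⇒p≤q⊔r)
open import Data.Rational.Solver using (module +-*-Solver)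
open import Data.Sum using (_⊎_; inj₁; inj₂)
open import Function using (id; _∘_)
open import Relation.Binary.PropositionalEquality using (_≡_; _≢_; refl; trans; cong; subst)
import Relation.Binary.PropositionalEquality as ≡
open import Relation.Nullary using (¬_; Dec; yes; no)
open import Relation.Nullary.Decidable using (_×-dec_)

private
  variable
    n : ℕ
    u v w x y z p : Fin n
    a b c d D m : ℚ

≤-addˡ : 0ℚ ≤ c → a ≤ b → a ≤ c + b
≤-addˡ {c} {a} {b} 0≤c a≤b = subst (_≤ c + b) (+-identityˡ a) (+-mono-≤ 0≤c a≤b)

5*-expand : ∀ m → (+ 5 / 1) * m ≡ m + ((m + (m + m)) + m)
5*-expand = solve 1 (λ m → con (+ 5 / 1) :* m := m :+ ((m :+ (m :+ m)) :+ m)) refl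
  where open +-*-Solver

4*-expand : ∀ m → (+ 4 / 1) * m ≡ m + (m + (m + m))
4*-expand = solve 1 (λ m → con (+ 4 / 1) :* m := m :+ (m :+ (m :+ m))) refl
  where open +-*-Solver

IsLeast : (ℚ → Set) → ℚ → Set
IsLeast P c = P c × (∀ c' → P c' → c ≤ c')

-- The constructive substitute for an infimum that is a minimum whenever it is finite.
MinOrEmpty : (ℚ → Set) → Set
MinOrEmpty P = (∀ c → ¬ P c) ⊎ ∃ (IsLeast P)

module _ {P Q : ℚ → Set} where

  MinOrEmpty-⇔ : (∀ {c} → P c → Q c) → (∀ {c} → Q c → P c) → MinOrEmpty P → MinOrEmpty Q
  MinOrEmpty-⇔ to from (inj₁ empty) = inj₁ λ c q → empty c (from q)
  MinOrEmpty-⇔ to from (inj₂ (c , pc , least)) = inj₂ (c , to pc , λ c' q → least c' (from q))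

  MinOrEmpty-⊎ : MinOrEmpty P → MinOrEmpty Q → MinOrEmpty (λ c → P c ⊎ Q c)
  MinOrEmpty-⊎ (inj₁ ∅P) (inj₁ ∅Q) = inj₁ λ { c (inj₁ pc) → ∅P c pc ; c (inj₂ qc) → ∅Q c qc }
  MinOrEmpty-⊎ (inj₁ ∅P) (inj₂ (d , qd , leastQ)) =
    inj₂ (d , inj₂ qd , λ { c (inj₁ pc) → ⊥-elim (∅P c pc) ; c (inj₂ qc) → leastQ c qc })
  MinOrEmpty-⊎ (inj₂ (c , pc , leastP)) (inj₁ ∅Q) =
    inj₂ (c , inj₁ pc , λ { c' (inj₁ pc') → leastP c' pc' ; c' (inj₂ qc') → ⊥-elim (∅Q c' qc') })
  MinOrEmpty-⊎ (inj₂ (c , pc , leastP)) (inj₂ (d , qd , leastQ)) with ≤-total c d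
  ... | inj₁ c≤d = inj₂ (c , inj₁ pc , λ { c' (inj₁ pc') → leastP c' pc' ; c' (inj₂ qc') → ≤-trans c≤d (leastQ c' qc') })
  ... | inj₂ d≤c = inj₂ (d , inj₂ qd , λ { c' (inj₁ pc') → ≤-trans d≤c (leastP c' pc') ; c' (inj₂ qc') → leastQ c' qc' })

MinOrEmpty-Fin : ∀ {m} {P : Fin m → ℚ → Set} → (∀ i → MinOrEmpty (P i)) → MinOrEmpty (λ c → ∃ λ i → P i c)
MinOrEmpty-Fin {zero} _ = inj₁ λ { c (() , _) }
MinOrEmpty-Fin {suc m} min =
  MinOrEmpty-⇔ (λ { (inj₁ p0) → zero , p0 ; (inj₂ (i , pi)) → suc i , pi })
               (λ { (zero , p0) → inj₁ p0 ; (suc i , pi) → inj₂ (i , pi) })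
               (MinOrEmpty-⊎ (min zero) (MinOrEmpty-Fin (min ∘ suc)))

MinOrEmpty-+ : ∀ {P : ℚ → Set} a → MinOrEmpty P → MinOrEmpty (λ c → ∃ λ d → P d × c ≡ a + d)
MinOrEmpty-+ a (inj₁ empty) = inj₁ λ { c (d , pd , _) → empty d pd }
MinOrEmpty-+ a (inj₂ (d , pd , least)) =
  inj₂ (a + d , (d , pd , refl) , λ { _ (d' , pd' , refl) → +-monoʳ-≤ a (least d' pd') })

MinOrEmpty-const : ∀ {X : Set} → Dec X → ∀ a → MinOrEmpty (λ c → X × c ≡ a)
MinOrEmpty-const (yes x) a = inj₂ (a , (x , refl) , λ { _ (_ , refl) → ≤-refl })
MinOrEmpty-const (no ¬x) a = inj₁ λ { _ (x , _) → ¬x x }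

leastIndex : ∀ {m} {P : Fin m → Set} → (∀ i → Dec (P i)) → ∃ P → ∃ λ i → P i × (∀ j → P j → i ≤ᶠ j)
leastIndex {suc m} P? (i , pi) with P? zero
... | yes p0 = zero , p0 , λ _ _ → z≤n
leastIndex {suc m} P? (zero , p0) | no ¬p0 = ⊥-elim (¬p0 p0)
leastIndex {suc m} P? (suc i , pi) | no ¬p0 with leastIndex (P? ∘ suc) (i , pi)
... | j , pj , least = suc j , pj , λ { zero p0 → ⊥-elim (¬p0 p0) ; (suc l) pl → s≤s (least l pl) }

unique⇒length≤ : ∀ {xs : List (Fin n)} → Unique xs → length xs ≤ℕ n
unique⇒length≤ {n} {xs} uniq with length xs ℕ.≤? n
... | yes len≤n = len≤n
... | no len≰n with Fin.pigeonhole (ℕ.≰⇒> len≰n) (lookup xs)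
...   | i , j , i<j , same = ⊥-elim (lookup-distinct uniq i<j same)
  where
  lookup-distinct : ∀ {A : Set} {ys : List A} → Unique ys → ∀ {i j} → i <ᶠ j → lookup ys i ≢ lookup ys j
  lookup-distinct (y∉ ∷ _) {zero} {suc j} _ = All.lookup y∉ (∈-lookup j)
  lookup-distinct (_ ∷ uniq) {suc i} {suc j} (s≤s i<j) = lookup-distinct uniq i<j

module _ {E : EdgeRel n} where

  _++ʷ_ : Walk E u v c → Walk E v z d → Walk E u z (c + d)
  _++ʷ_ {d = d} here w = subst (Walk E _ _) (≡.sym (+-identityˡ d)) w
  _++ʷ_ {d = d'} (step {c = c} {d = d} e w) w' = subst (Walk E _ _) (≡.sym (+-assoc c d d')) (step e (w ++ʷ w'))

  singleton : E u v c → Walk E u v c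
  singleton {c = c} e = subst (Walk E _ _) (+-identityʳ c) (step e here)

  reverse : (∀ {u v c} → E u v c → E v u c) → Walk E u v c → Walk E v u c
  reverse E-sym here = here
  reverse E-sym (step {c = c} {d = d} e w) =
    subst (Walk E _ _) (+-comm d c) (reverse E-sym w ++ʷ singleton (E-sym e))

  vertices : Walk E u v c → List (Fin n)
  vertices here = []
  vertices (step {u = u} _ w) = u ∷ vertices w

  Walk⇒DistLeq : Walk E u v c → DistLeq E u v c
  Walk⇒DistLeq w = _ , w , ≤-refl

  DistLeq-refl : 0ℚ ≤ D → DistLeq E u u D
  DistLeq-refl 0≤D = 0ℚ , here , 0≤D

  DistLeq-weaken : c ≤ d → DistLeq E u v c → DistLeq E u v d
  DistLeq-weaken c≤d (c' , w , c'≤c) = c' , w , ≤-trans c'≤c c≤d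

  DistLeq-trans : DistLeq E u v c → DistLeq E v z d → DistLeq E u z (c + d)
  DistLeq-trans (c' , w , c'≤c) (d' , w' , d'≤d) = c' + d' , w ++ʷ w' , +-mono-≤ c'≤c d'≤d

  DistLeq-sym : (∀ {u v c} → E u v c → E v u c) → DistLeq E u v c → DistLeq E v u c
  DistLeq-sym E-sym (c' , w , c'≤c) = c' , reverse E-sym w , c'≤c

SetDistGt : EdgeRel n → Subset n → Fin n → ℚ → Set
SetDistGt E A u D = ∀ a → a ∈ A → ∀ c → Walk E u a c → D < c

SetDistLeq : EdgeRel n → Subset n → Fin n → ℚ → Set
SetDistLeq E A u D = ∃ λ a → a ∈ A × DistLeq E u a D

module _ (G : Graph n) where

  private
    E = GEdge G
    open import Data.List.Membership.DecPropositional (Fin._≟_ {n}) using () renaming (_∈?_ to _∈ₗ?_)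

  GEdge-sym : E u v c → E v u c
  GEdge-sym {u} {v} e = trans (sym G v u) e

  Walk-nonneg : Walk E u v c → 0ℚ ≤ c
  Walk-nonneg here = ≤-refl
  Walk-nonneg (step {u} {v} {c = c} e w) = +-mono-≤ (nonneg G u v c e) (Walk-nonneg w)

  IsDist-sym : IsDist E u v c → IsDist E v u c
  IsDist-sym (w , least) = reverse GEdge-sym w , λ c' w' → least c' (reverse GEdge-sym w')

  suffixFrom : (w : Walk E v z d) → u ∈ₗ vertices w →
               ∃ λ d' → Σ (Walk E u z d') λ w' → d' ≤ d × (Unique (vertices w) → Unique (vertices w'))
  suffixFrom (step e w) (here refl) = _ , step e w , ≤-refl , id
  suffixFrom (step e w) (there u∈w) with suffixFrom w u∈w
  ... | d' , w' , d'≤d , uniq = d' , w' , ≤-addˡ (nonneg G _ _ _ e) d'≤d , λ { (_ ∷ uniqTail) → uniq uniqTail }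

  -- Cutting out closed subwalks does not increase the weight since weights are non-negative.
  shortcut : (w : Walk E u z c) → ∃ λ c' → Σ (Walk E u z c') λ w' → c' ≤ c × Unique (vertices w')
  shortcut here = 0ℚ , here , ≤-refl , []
  shortcut (step {u} {c = c} e w) with shortcut w
  ... | d , w' , d≤ , uniq with u ∈ₗ? vertices w'
  ...   | no u∉ = c + d , step e w' , +-monoʳ-≤ c d≤ , ¬Any⇒All¬ _ u∉ ∷ uniq
  ...   | yes u∈ with suffixFrom w' u∈
  ...     | d' , w'' , d'≤d , uniq' = d' , w'' , ≤-trans d'≤d (≤-addˡ (nonneg G _ _ _ e) d≤) , uniq' uniq

  WalkWithin : ℕ → Fin n → Fin n → ℚ → Set
  WalkWithin ℓ u v c = Σ (Walk E u v c) λ w → length (vertices w) ≤ℕ ℓ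

  WalkWithin-min : ∀ ℓ u v → MinOrEmpty (WalkWithin ℓ u v)
  WalkWithin-min zero u v =
    MinOrEmpty-⇔ (λ { (refl , refl) → here , z≤n }) (λ { (here , _) → refl , refl ; (step _ _ , ()) })
                 (MinOrEmpty-const (u Fin.≟ v) 0ℚ)
  WalkWithin-min (suc ℓ) u v =
    MinOrEmpty-⇔ to from (MinOrEmpty-⊎ (MinOrEmpty-const (u Fin.≟ v) 0ℚ) (MinOrEmpty-Fin first-step))
    where
    FirstStep : Fin n → ℚ → Set
    FirstStep w c = ∃ λ c₁ → E u w c₁ × ∃ λ d → WalkWithin ℓ w v d × c ≡ c₁ + d

    first-step : ∀ w → MinOrEmpty (FirstStep w)
    first-step w with edge G u w
    ... | nothing = inj₁ λ { c (_ , () , _) }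
    ... | just c₁ =
      MinOrEmpty-⇔ (λ { (d , ww , c≡) → c₁ , refl , d , ww , c≡ })
                   (λ { (_ , e , d , ww , c≡) → d , ww , trans c≡ (cong (_+ d) (≡.sym (just-injective e))) })
                   (MinOrEmpty-+ c₁ (WalkWithin-min ℓ w v))

    to : ∀ {c} → (u ≡ v × c ≡ 0ℚ) ⊎ ∃ (λ w → FirstStep w c) → WalkWithin (suc ℓ) u v c
    to (inj₁ (refl , refl)) = here , z≤n
    to (inj₂ (_ , _ , e , _ , (w , len) , refl)) = step e w , s≤s len

    from : ∀ {c} → WalkWithin (suc ℓ) u v c → (u ≡ v × c ≡ 0ℚ) ⊎ ∃ (λ w → FirstStep w c)
    from (here , _) = inj₁ (refl , refl)
    from (step e w , s≤s len) = inj₂ (_ , _ , e , _ , (w , len) , refl)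

  distance : ∀ u v → MinOrEmpty (Walk E u v)
  distance u v with WalkWithin-min n u v
  ... | inj₁ none = inj₁ λ c w → let c' , w' , _ , uniq = shortcut w in none c' (w' , unique⇒length≤ uniq)
  ... | inj₂ (c , (w , _) , least) = inj₂ (c , w , λ c' w' →
          let c'' , w'' , c''≤c' , uniq = shortcut w' in ≤-trans (least c'' (w'' , unique⇒length≤ uniq)) c''≤c')

  DistLeq⇒IsDist : DistLeq E u v D → ∃ λ d → IsDist E u v d × d ≤ D
  DistLeq⇒IsDist {u} {v} (c , w , c≤D) with distance u v
  ... | inj₁ none = ⊥-elim (none c w)
  ... | inj₂ (d , isd) = d , isd , ≤-trans (proj₂ isd c w) c≤D

  DistLeq? : ∀ u v D → Dec (DistLeq E u v D)
  DistLeq? u v D with distance u v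
  ... | inj₁ none = no λ (c , w , _) → none c w
  ... | inj₂ (d , w , least) with d ≤? D
  ...   | yes d≤D = yes (d , w , d≤D)
  ...   | no d≰D = no λ (c , w' , c≤D) → d≰D (≤-trans (least c w') c≤D)

  setDistance : ∀ A u → MinOrEmpty (λ c → ∃ λ a → a ∈ A × Walk E u a c)
  setDistance A u = MinOrEmpty-Fin member
    where
    member : ∀ a → MinOrEmpty (λ c → a ∈ A × Walk E u a c)
    member a with a ∈? A
    ... | yes a∈ = MinOrEmpty-⇔ (a∈ ,_) proj₂ (distance u a)
    ... | no a∉ = inj₁ λ c (a∈ , _) → a∉ a∈

  setDist-compare : ∀ A u D → SetDistGt E A u D ⊎ SetDistLeq E A u D
  setDist-compare A u D with setDistance A u
  ... | inj₁ none = inj₁ λ a a∈ c w → ⊥-elim (none c (a , a∈ , w))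
  ... | inj₂ (δ , (a , a∈ , w) , least) with D <? δ
  ...   | yes D<δ = inj₁ λ a a∈ c w → <-≤-trans D<δ (least c (a , a∈ , w))
  ...   | no D≮δ = inj₂ (a , a∈ , δ , w , ≮⇒≥ D≮δ)

  pivot-exists : ∀ {A} → SetDistLeq E A v D → ∃ λ p → IsPivot G A v p × ∃ λ d → IsDist E v p d × d ≤ D
  pivot-exists {v} {A = A} (a , a∈ , c , wa , c≤D) with setDistance A v
  ... | inj₁ none = ⊥-elim (none c (a , a∈ , wa))
  ... | inj₂ (δ , (a₀ , a₀∈ , w₀) , least)
    with leastIndex (λ b → b ∈? A ×-dec DistLeq? v b δ) (a₀ , a₀∈ , δ , w₀ , ≤-refl)
  ... | p , (p∈ , d , wp , d≤δ) , leastIdx =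
    p , (p∈ , λ b b∈ → closest b b∈ , λ tie → leastIdx b (b∈ , DistLeq-weaken d≤δ (tie d wp))) ,
    d , (wp , λ c' w' → ≤-trans d≤δ (least c' (p , p∈ , w'))) ,
    ≤-trans d≤δ (≤-trans (least c (a , a∈ , wa)) c≤D)
    where
    closest : ∀ b → b ∈ A → DistLeDist E v p v b
    closest b b∈ c' w' = d , wp , ≤-trans d≤δ (least c' (b , b∈ , w'))

module _ (G : Graph n) (k : ℕ) (A : ℕ → Subset n) (hierarchy : Hierarchy k A) where

  private
    E = GEdge G
    H = HEdge G k A

  ∈A₀ : u ∈ A 0
  ∈A₀ {u = u} = subst (u ∈_) (≡.sym (A0 hierarchy)) ∈⊤

  ∉Aₖ : u ∉ A k
  ∉Aₖ {u = u} u∈ = ∉⊥ (subst (u ∈_) (Ak hierarchy) u∈)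

  nonempty⇒<k : ∀ {j} → j ≤ℕ k → u ∈ A j → j <ℕ k
  nonempty⇒<k j≤k u∈ with ℕ.m≤n⇒m<n∨m≡n j≤k
  ... | inj₁ j<k = j<k
  ... | inj₂ refl = ⊥-elim (∉Aₖ u∈)

  level-below : ∀ i → u ∉ A i → ∃ λ j → j <ℕ i × u ∈ A j × u ∉ A (suc j)
  level-below zero u∉ = ⊥-elim (u∉ ∈A₀)
  level-below {u = u} (suc i) u∉ with u ∈? A i
  ... | yes u∈ = i , ℕ.n<1+n i , u∈ , u∉
  ... | no u∉' = let j , j<i , rest = level-below i u∉' in j , ℕ.m<n⇒m<1+n j<i , rest

  H-sym : H u v c → H v u c
  H-sym (inj₁ v∈B , isd) = inj₂ v∈B , IsDist-sym G isd
  H-sym (inj₂ u∈B , isd) = inj₁ u∈B , IsDist-sym G isd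

  H-walk⇒G-walk : Walk H u v c → Walk E u v c
  H-walk⇒G-walk here = here
  H-walk⇒G-walk (step (_ , (w , _)) ws) = w ++ʷ H-walk⇒G-walk ws

  H-DistLeq⇒G-DistLeq : DistLeq H u v D → DistLeq E u v D
  H-DistLeq⇒G-DistLeq (c , w , c≤D) = c , H-walk⇒G-walk w , c≤D

  pivot-edge : ∀ {i} → i <ℕ k → x ∉ A (suc i) → IsPivot G (A (suc i)) x p → IsDist E x p D → Walk H x p D
  pivot-edge {i = i} i<k x∉ piv isd =
    let j , j<1+i , x∈ , x∉' = level-below (suc i) x∉
        1+i<k = nonempty⇒<k i<k (proj₁ piv)
    in singleton (inj₁ (j , ℕ.<-trans j<1+i 1+i<k , x∈ , x∉' , inj₂ (suc i , j<1+i , 1+i<k , piv)) , isd)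

  -- u ∉ A (suc j) is forced: otherwise d(u, A (suc j)) = 0 ≤ c.
  ball-edge : ∀ {j} → j <ℕ k → u ∈ A j → v ∈ A j → IsDist E u v c → SetDistGt E (A (suc j)) u c → Walk H u v c
  ball-edge {u = u} {j = j} j<k u∈ v∈ isd@(w , _) far with u ∈? A (suc j)
  ... | yes u∈' = ⊥-elim (<-irrefl refl (<-≤-trans (far u u∈' 0ℚ here) (Walk-nonneg G w)))
  ... | no u∉ = singleton (inj₁ (j , j<k , u∈ , u∉ , inj₁ (v∈ , _ , w , far)) , isd)

  climb : ∀ {j} → j <ℕ k → w ∈ A j → SetDistLeq E (A (suc j)) w 0ℚ → ∃ λ w' → w' ∈ A (suc j) × DistLeq H w w' 0ℚ
  climb {w = w} {j = j} j<k w∈ near with w ∈? A (suc j)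
  ... | yes w∈' = w , w∈' , DistLeq-refl ≤-refl
  ... | no w∉ with pivot-exists G near
  ...   | p , piv , d , isd , d≤0 = p , proj₁ piv , d , pivot-edge j<k w∉ piv isd , d≤0

  zero-distance-in-H : ∀ t j → t +ℕ j ≡ k → u ∈ A j → v ∈ A j → DistLeq E u v 0ℚ → DistLeq H u v 0ℚ
  zero-distance-in-H zero j refl u∈ _ _ = ⊥-elim (∉Aₖ u∈)
  zero-distance-in-H {u = u} {v = v} (suc t) j t+j≡k u∈ v∈ uv
    with subst (j <ℕ_) t+j≡k (ℕ.m<n+m j (s≤s z≤n)) | setDist-compare G (A (suc j)) u 0ℚ
  ... | j<k | inj₁ far =
    let c , isd , c≤0 = DistLeq⇒IsDist G uv
    in c , ball-edge j<k u∈ v∈ isd (λ a a∈ c' w → ≤-<-trans c≤0 (far a a∈ c' w)) , c≤0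
  ... | j<k | inj₂ (a , a∈ , ua) =
    let u' , u'∈ , uu' = climb j<k u∈ (a , a∈ , ua)
        v' , v'∈ , vv' = climb j<k v∈ (a , a∈ , DistLeq-trans (DistLeq-sym (GEdge-sym G) uv) ua)
        u'v' = DistLeq-trans (DistLeq-sym (GEdge-sym G) (H-DistLeq⇒G-DistLeq uu'))
                             (DistLeq-trans uv (H-DistLeq⇒G-DistLeq vv'))
    in DistLeq-trans uu' (DistLeq-trans (zero-distance-in-H t (suc j) (trans (ℕ.+-suc t j) t+j≡k) u'∈ v'∈ u'v')
                                        (DistLeq-sym H-sym vv'))

  pivot-reachable : ∀ {i} → i <ℕ k → IsPivot G (A (suc i)) x p → IsDist E x p D → DistLeq H x p D
  pivot-reachable {x = x} {i = i} i<k piv isd with x ∈? A (suc i)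
  ... | no x∉ = Walk⇒DistLeq (pivot-edge i<k x∉ piv isd)
  ... | yes x∈ =
    DistLeq-weaken (Walk-nonneg G (proj₁ isd))
      (zero-distance-in-H (k ∸ suc i) (suc i) (ℕ.m∸n+n≡m i<k) x∈ (proj₁ piv) (proj₁ (proj₂ piv x x∈) 0ℚ here))

  near-pivot : ∀ {i} → i <ℕ k → SetDistLeq E (A (suc i)) x D → ∃ λ p → IsPivotAt G A (suc i) x p × DistLeq H x p D
  near-pivot i<k near =
    let p , piv , d , isd , d≤D = pivot-exists G near
    in p , piv , DistLeq-weaken d≤D (pivot-reachable i<k piv isd)

  -- x itself if x ∈ A i; otherwise p_i(x), which then lies in the bunch of x.
  anchor : ∀ {i} → i <ℕ k → IsPivotAt G A i x p → IsDist E x p D →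
           ∃ λ a → a ∈ A i × DistLeq E x a D × DistLeq H x a D
  anchor {x = x} {i = i} i<k piv (w , _) with x ∈? A i
  ... | yes x∈ = x , x∈ , DistLeq-refl (Walk-nonneg G w) , DistLeq-refl (Walk-nonneg G w)
  anchor {i = zero} _ _ _ | no x∉ = ⊥-elim (x∉ ∈A₀)
  anchor {p = p} {i = suc i} i<k piv isd@(w , _) | no x∉ =
    p , proj₁ piv , Walk⇒DistLeq w , Walk⇒DistLeq (pivot-edge (ℕ.<⇒≤ i<k) x∉ piv isd)

  stretch-bound : ∀ {i} {px py dx dy dxy} → i <ℕ k →
    IsPivotAt G A i x px → IsPivotAt G A i y py →
    IsDist E x px dx → IsDist E y py dy → IsDist E x y dxy →
    dx ≤ m → dy ≤ m → dxy ≤ m →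
    DistLeq H x y ((+ 5 / 1) * m) ⊎ ∃ λ p → IsPivotAt G A (suc i) x p × DistLeq H x p ((+ 4 / 1) * m)
  stretch-bound {x} {y} {m} {i} i<k pvx pvy isx isy (wxy , _) dx≤m dy≤m dxy≤m
    with anchor i<k pvx isx | anchor i<k pvy isy
  ... | a , a∈ , xa , xaᴴ | b , b∈ , yb , ybᴴ
    with DistLeq⇒IsDist G (DistLeq-weaken (+-mono-≤ dx≤m (+-mono-≤ dxy≤m dy≤m))
           (DistLeq-trans (DistLeq-sym (GEdge-sym G) xa) (DistLeq-trans (Walk⇒DistLeq wxy) yb)))
  ... | dab , ab , dab≤3m with setDist-compare G (A (suc i)) a dab
  ... | inj₁ far =
    inj₁ (DistLeq-weaken (≤-trans (+-mono-≤ dx≤m (+-mono-≤ dab≤3m dy≤m)) (≤-reflexive (≡.sym (5*-expand m))))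
           (DistLeq-trans xaᴴ (DistLeq-trans (Walk⇒DistLeq (ball-edge i<k a∈ b∈ ab far)) (DistLeq-sym H-sym ybᴴ))))
  ... | inj₂ (a' , a'∈ , aa') =
    let p , piv , xp = near-pivot i<k (a' , a'∈ , DistLeq-trans xa aa')
    in inj₂ (p , piv , DistLeq-weaken (≤-trans (+-mono-≤ dx≤m dab≤3m) (≤-reflexive (≡.sym (4*-expand m)))) xp)

lemma3p2 : {n : ℕ} (G : Graph n) (k : ℕ) → 1 ≤ℕ k → (A : ℕ → Subset n) → Hierarchy k A →
    (i : ℕ) → i <ℕ k → (x y px py : Fin n) (dx dy dxy : ℚ) →
    IsPivotAt G A i x px → IsPivotAt G A i y py →
    IsDist (GEdge G) x px dx → IsDist (GEdge G) y py dy → IsDist (GEdge G) x y dxy →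
    DistLeq (HEdge G k A) x y ((+ 5 / 1) * (dx ⊔ dy ⊔ dxy))
    ⊎ Σ (Fin n) (λ p → IsPivotAt G A (suc i) x p × DistLeq (HEdge G k A) x p ((+ 4 / 1) * (dx ⊔ dy ⊔ dxy)))
lemma3p2 G k _ A hierarchy i i<k x y px py dx dy dxy pvx pvy isx isy isxy =
  stretch-bound G k A hierarchy i<k pvx pvy isx isy isxy
    (p≤q⇒p≤q⊔r dxy (p≤p⊔q dx dy)) (p≤q⇒p≤q⊔r dxy (p≤q⊔p dx dy)) (p≤q⊔p (dx ⊔ dy) dxy)
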